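{- Let $p$ be a prime, $n=p^2$, and let $\Gamma=\Gamma(D_{2n})$ be the intersection graph of $D_{2n}$. Then the first Zagreb index of $\Gamma$ is $M_1(\Gamma)=4p^3+7p^2+5p+2$.
   Context: $D_{2n}=\langle r,s : r^n=s^2=1,\ srs=r^{ -1}\rangle$ is the dihedral group of order $2n$. The intersection graph $\Gamma(G)$ of a finite group $G$ has as vertices the proper non-trivial subgroups of $G$, two distinct vertices being adjacent iff their intersection is non-trivial. The first Zagreb index is $M_1(\Gamma)=\sum_{v\in V(\Gamma)}\deg(v)^2$. -}

module Defs where

open import Data.Nat using (ℕ; zero; suc; _+_; _∸_; _^_; _<_; _<?_)
open import Data.Nat.DivMod using (_mod_)
open import Data.Fin using (Fin; toℕ; splitAt; join)
open import Data.Sum using (_⊎_; inj₁; inj₂)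
open import Data.Product using (_×_; ∃)
open import Data.Bool using (Bool)
open import Data.Bool.Properties using () renaming (_≟_ to _≟ᵇ_)
open import Data.List using (List; []; _∷_; _++_; map; filter; length)
open import Data.Nat.ListAction using (sum)
open import Data.Vec using (Vec; []; _∷_)
open import Data.Vec.Properties using (≡-dec)
open import Data.Fin.Subset using (Subset; inside; outside; _∈_; _∉_; _∩_; ∣_∣; Nonempty)
open import Data.Fin.Subset.Properties using (_∈?_; nonempty?)
open import Data.Fin.Properties using (all?; any?)
open import Relation.Nullary using (¬_; Dec; yes; no; _×-dec_; ¬?)
open import Relation.Binary.PropositionalEquality using (_≡_)

-- Arithmetic in ℤ/nℤ on Fin n (n = 0 is vacuous: Fin 0 is empty).

_⊕_ : ∀ {n} → Fin n → Fin n → Fin n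
_⊕_ {suc m} a b = (toℕ a + toℕ b) mod suc m

_⊖_ : ∀ {n} → Fin n → Fin n → Fin n
_⊖_ {suc m} a b = (toℕ a + (suc m ∸ toℕ b)) mod suc m

-- Normal form:  inj₁ k  represents  r^k,   inj₂ k  represents  r^k s
-- (k ∈ ℤ/nℤ).  Using  s r^b = r^{-b} s  we get the multiplication below.

D : ℕ → Set
D n = Fin n ⊎ Fin n

mulD : ∀ {n} → D n → D n → D n
mulD (inj₁ a) (inj₁ b) = inj₁ (a ⊕ b)   -- r^a r^b     = r^(a+b)
mulD (inj₁ a) (inj₂ b) = inj₂ (a ⊕ b)   -- r^a r^b s   = r^(a+b) s
mulD (inj₂ a) (inj₁ b) = inj₂ (a ⊖ b)   -- r^a s r^b   = r^(a-b) s
mulD (inj₂ a) (inj₂ b) = inj₁ (a ⊖ b)   -- r^a s r^b s = r^(a-b)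

invD : ∀ {n} → D n → D n
invD {suc m} (inj₁ a) = inj₁ (Data.Fin.zero ⊖ a)
invD (inj₂ a) = inj₂ a                               -- (r^a s)² = 1

-- Elements of D_{2n} indexed by Fin (n + n) (first n: rotations, last n: reflections),
-- so that subsets of D_{2n} are the stdlib's  Subset (n + n).
El : ℕ → Set
El n = Fin (n + n)

_·_ : ∀ {n} → El n → El n → El n
_·_ {n} x y = join n n (mulD (splitAt n x) (splitAt n y))

inv : ∀ {n} → El n → El n
inv {n} x = join n n (invD (splitAt n x))

IsSubgroup : ∀ n → Subset (n + n) → Set
IsSubgroup n H =
  Nonempty H
  × (∀ x y → x ∈ H → y ∈ H → (_·_ {n} x y) ∈ H)
  × (∀ x → x ∈ H → inv {n} x ∈ H)

-- Every subgroup contains the identity, so a subgroup (or an intersection of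
-- subgroups, which is again a subgroup) is non-trivial iff it has ≥ 2 elements.
NonTrivial : ∀ {m} → Subset m → Set
NonTrivial H = 1 < ∣ H ∣

Proper : ∀ {m} → Subset m → Set
Proper H = ∃ λ x → x ∉ H

IsVertex : ∀ n → Subset (n + n) → Set
IsVertex n H = IsSubgroup n H × Proper H × NonTrivial H

Adjacent : ∀ {m} → Subset m → Subset m → Set
Adjacent H K = (¬ H ≡ K) × NonTrivial (H ∩ K)

private
  imp? : ∀ {A B : Set} → Dec A → Dec B → Dec (A → B)
  imp? (yes a) (yes b) = yes (λ _ → b)
  imp? (yes a) (no ¬b) = no (λ f → ¬b (f a))
  imp? (no ¬a) _       = yes (λ a → Data.Empty.⊥-elim (¬a a))
    where import Data.Empty

isSubgroup? : ∀ n H → Dec (IsSubgroup n H)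
isSubgroup? n H =
  nonempty? H
  ×-dec all? (λ x → all? (λ y → imp? (x ∈? H) (imp? (y ∈? H) (_·_ {n} x y ∈? H))))
  ×-dec all? (λ x → imp? (x ∈? H) (inv {n} x ∈? H))

isVertex? : ∀ n H → Dec (IsVertex n H)
isVertex? n H =
  isSubgroup? n H ×-dec any? (λ x → ¬? (x ∈? H)) ×-dec (1 <? ∣ H ∣)

adjacent? : ∀ {m} (H K : Subset m) → Dec (Adjacent H K)
adjacent? H K = ¬? (≡-dec _≟ᵇ_ H K) ×-dec (1 <? ∣ H ∩ K ∣)

allSubsets : ∀ m → List (Subset m)
allSubsets zero    = [] ∷ []
allSubsets (suc m) = map (inside ∷_) (allSubsets m) ++ map (outside ∷_) (allSubsets m)

vertices : ∀ n → List (Subset (n + n))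
vertices n = filter (isVertex? n) (allSubsets (n + n))

degree : ∀ n → Subset (n + n) → ℕ
degree n H = length (filter (adjacent? H) (vertices n))

M₁ : ℕ → ℕ
M₁ n = sum (map (λ H → degree n H ^ 2) (vertices n))

-- Every subgroup of D_{2n} is ⟨r^d⟩ or ⟨r^d, r^b s⟩ where ⟨r^d⟩ is its group of rotations.  For
-- n = p² the rotation exponents form a subgroup of ℤ/p², so by Bézout d ∈ {1, p, p²}; hence the
-- vertices of Γ are ⟨r⟩, ⟨r^p⟩, the p subgroups ⟨r^p, r^i s⟩ (i < p) and the p² subgroups ⟨r^b s⟩.
-- The first p + 2 all contain r^p and are pairwise adjacent, while ⟨r^b s⟩ meets exactly one
-- vertex, ⟨r^p, r^i s⟩ with i ≡ b (mod p).  The degrees are therefore p + 1 (twice), 2p + 1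
-- (p times) and 1 (p² times), and M₁ = 2(p + 1)² + p(2p + 1)² + p² = 4p³ + 7p² + 5p + 2.
module Submission where

open import Defs
open import Data.Nat using (ℕ; _+_; _*_; _^_)
open import Data.Nat.Primality using (Prime)
open import Relation.Binary.PropositionalEquality using (_≡_)

open import Data.Bool using (true; false)
open import Data.Empty using (⊥; ⊥-elim)
open import Data.Fin using (Fin; toℕ; fromℕ<; splitAt; join; combine)
open import Data.Fin.Patterns using (0F)
open import Data.Fin.Properties
  using (toℕ-fromℕ<; toℕ-injective; toℕ<n; any?; splitAt-join; join-splitAt;
         combine-surjective; combine-injective; toℕ-combine)
  renaming (_≟_ to _≟ᶠ_)
open import Data.Fin.Subset using (Subset; _∈_; _⊆_; ⁅_⁆; ∣_∣; inside; outside)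
open import Data.Fin.Subset.Properties
  using (_∈?_; x∈⁅x⁆; x∈⁅y⁆⇒x≡y; ∣⁅x⁆∣≡1; p⊆q⇒∣p∣≤∣q∣; p⊂q⇒∣p∣<∣q∣; ⊆-antisym; x∈p∩q⁺; x∈p∩q⁻)
open import Data.List using (List; []; _∷_; _++_; map; filter; length; allFin; cartesianProductWith)
open import Data.List.Properties
  using (length-tabulate; length-++; length-map; map-++; map-∘; map-cong;
         filter-++; filter-all; filter-none; filter-accept; filter-reject)
open import Data.List.Membership.Propositional using () renaming (_∈_ to _∈ˡ_)
open import Data.List.Membership.Propositional.Properties
  using (∈-map⁺; ∈-map⁻; ∈-++⁺ˡ; ∈-++⁺ʳ; ∈-allFin; ∈-filter⁺; ∈-filter⁻; ∈-cartesianProductWith⁺)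
open import Data.List.Membership.Propositional.Properties.WithK using (unique∧set⇒bag)
open import Data.List.Relation.Binary.BagAndSetEquality using (∼bag⇒↭)
open import Data.List.Relation.Binary.Permutation.Propositional using (_↭_)
open import Data.List.Relation.Binary.Permutation.Propositional.Properties
  using (↭-length; filter-↭) renaming (map⁺ to ↭-map⁺)
open import Data.List.Relation.Unary.All using (All; []; _∷_)
import Data.List.Relation.Unary.All as All
import Data.List.Relation.Unary.All.Properties as All
open import Data.List.Relation.Unary.AllPairs using ([]; _∷_)
open import Data.List.Relation.Unary.Any using (here; there)
open import Data.List.Relation.Unary.Unique.Propositional using (Unique)
import Data.List.Relation.Unary.Unique.Propositional.Properties as Unique
open import Data.Maybe using (Maybe; just; nothing)
open import Data.Nat using (zero; suc; _≟_; _∸_; _<_; _≤_; NonZero; NonTrivial; ≢-nonZero; z≤n; s≤s)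
open import Data.Nat.Coprimality
  using (Coprime; coprime-divisor; coprime⇒gcd≡1; prime⇒coprime) renaming (sym to coprime-sym)
open import Data.Nat.Divisibility
  using (_∣_; divides; _∣?_; _∣0; 1∣_; m∣m*n; ∣-refl; ∣-trans; >⇒∤; ∣n∣m%n⇒∣m; ∣m∣n⇒∣m+n; ∣m+n∣m⇒∣n;
         %-presˡ-∣; m%n≡0⇒n∣m; n∣m⇒m%n≡0)
open import Data.Nat.DivMod
  using (_%_; _mod_; n%1≡0; m%n<n; m<n⇒m%n≡m; m%n%n≡m%n; n%n≡0; [m+n]%n≡m%n; [m+kn]%n≡m%n;
         %-distribˡ-+; %-remove-+ˡ; %-remove-+ʳ; m∣n⇒o%n%m≡o%m)
open import Data.Nat.GCD using (gcd; gcd-GCD; c*gcd[m,n]≡gcd[cm,cn]; module Bézout)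
open import Data.Nat.ListAction using (sum)
open import Data.Nat.ListAction.Properties using (sum-++; sum-↭)
open import Data.Nat.Primality using (prime⇒irreducible; prime⇒nonTrivial)
open import Data.Nat.Properties
  using (+-assoc; +-comm; *-identityʳ; *-comm; *-assoc; *-cancelʳ-<; m+[n∸m]≡n; m∸n+n≡m;
         <⇒≤; <⇒≱; <-trans; m<m*n; 1+n≢0; suc-injective; +-commutativeSemigroup)
open import Algebra.Properties.CommutativeSemigroup +-commutativeSemigroup using (x∙yz≈y∙xz)
open import Data.Nat.Tactic.RingSolver using (solve-∀)
open import Data.Product using (∃; _×_; _,_; proj₁; proj₂)
open import Data.Sum using (_⊎_; inj₁; inj₂)
open import Data.Sum.Properties using (inj₁-injective)
open import Data.Vec using (tabulate; []; _∷_)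
open import Data.Vec.Properties using (lookup∘tabulate; []=⇒lookup; lookup⇒[]=; ∷-injectiveʳ)
open import Function.Base using (_∘_; id)
open import Function.Bundles using (_⇔_; mk⇔; Equivalence)
open Equivalence using (to; from)
open import Function.Properties.Equivalence using () renaming (trans to ⇔-trans; sym to ⇔-sym)
open import Relation.Binary.PropositionalEquality
  using (_≢_; refl; sym; trans; cong; cong₂; subst; module ≡-Reasoning)
open import Relation.Nullary using (¬_; Dec; yes; no; ¬?; _×-dec_)
open import Relation.Nullary.Decidable using (does; dec-true; decidable-stable)
open import Relation.Unary using (Pred; Decidable; ∁)

open ≡-Reasoning

-- Arithmetic

coprime-* : ∀ {a b c} → Coprime a b → Coprime a c → Coprime a (b * c)
coprime-* a⊥b a⊥c (d∣a , d∣bc) =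
  a⊥c (d∣a , coprime-divisor (λ (e∣d , e∣b) → a⊥b (∣-trans e∣d d∣a , e∣b)) d∣bc)

prime∤⇒coprime : ∀ {p a} → Prime p → ¬ p ∣ a → Coprime a p
prime∤⇒coprime p-prime p∤a (d∣a , d∣p) with prime⇒irreducible p-prime d∣p
... | inj₁ d≡1  = d≡1
... | inj₂ refl = ⊥-elim (p∤a d∣a)

gcd[u*p,p*p]≡p : ∀ {p u} → Prime p → u ≢ 0 → u < p → gcd (u * p) (p * p) ≡ p
gcd[u*p,p*p]≡p {p} {u} p-prime u≢0 u<p = begin
  gcd (u * p) (p * p) ≡⟨ cong (λ t → gcd t (p * p)) (*-comm u p) ⟩
  gcd (p * u) (p * p) ≡⟨ c*gcd[m,n]≡gcd[cm,cn] p u p ⟨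
  p * gcd u p         ≡⟨ cong (p *_) (coprime⇒gcd≡1 u⊥p) ⟩
  p * 1               ≡⟨ *-identityʳ p ⟩
  p                   ∎
  where u⊥p = coprime-sym (prime⇒coprime p-prime {{≢-nonZero u≢0}} u<p)

toℕ-mod : ∀ j d .{{_ : NonZero d}} → toℕ (j mod d) ≡ j % d
toℕ-mod j d = toℕ-fromℕ< (m%n<n j d)

toℕ-mod-% : ∀ j d .{{_ : NonZero d}} → toℕ (j mod d) % d ≡ j % d
toℕ-mod-% j d = trans (cong (_% d) (toℕ-mod j d)) (m%n%n≡m%n j d)

toℕ%-injective : ∀ {d} .{{_ : NonZero d}} {a b : Fin d} → toℕ a % d ≡ toℕ b % d → a ≡ b
toℕ%-injective {a = a} {b} eq =
  toℕ-injective (trans (sym (m<n⇒m%n≡m (toℕ<n a))) (trans eq (m<n⇒m%n≡m (toℕ<n b))))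

module _ {d n : ℕ} .{{_ : NonZero d}} .{{_ : NonZero n}} (d∣n : d ∣ n) where

  ∣n∸ : ∀ {a} → a ≤ n → d ∣ a → d ∣ n ∸ a
  ∣n∸ a≤n d∣a = ∣m+n∣m⇒∣n (subst (d ∣_) (sym (m+[n∸m]≡n a≤n)) d∣n) d∣a

  ∣+∸⇔%≡% : ∀ {x y} → y ≤ n → d ∣ x + (n ∸ y) ⇔ x % d ≡ y % d
  ∣+∸⇔%≡% {x} {y} y≤n = mk⇔ forward backward
    where
    forward : d ∣ x + (n ∸ y) → x % d ≡ y % d
    forward d∣ = begin
      x % d                   ≡⟨ %-remove-+ʳ x d∣n ⟨
      (x + n) % d             ≡⟨ cong (λ t → (x + t) % d) (m+[n∸m]≡n y≤n) ⟨
      (x + (y + (n ∸ y))) % d ≡⟨ cong (_% d) (x∙yz≈y∙xz x y (n ∸ y)) ⟩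
      (y + (x + (n ∸ y))) % d ≡⟨ %-remove-+ʳ y d∣ ⟩
      y % d                   ∎
    backward : x % d ≡ y % d → d ∣ x + (n ∸ y)
    backward x≡y = m%n≡0⇒n∣m _ d (begin
      (x + (n ∸ y)) % d         ≡⟨ %-distribˡ-+ x (n ∸ y) d ⟩
      (x % d + (n ∸ y) % d) % d ≡⟨ cong (λ t → (t + (n ∸ y) % d) % d) x≡y ⟩
      (y % d + (n ∸ y) % d) % d ≡⟨ %-distribˡ-+ y (n ∸ y) d ⟨
      (y + (n ∸ y)) % d         ≡⟨ cong (_% d) (m+[n∸m]≡n y≤n) ⟩
      n % d                     ≡⟨ n∣m⇒m%n≡0 n d d∣n ⟩
      0                         ∎)

-- Lists and subsets

unique∧set⇒↭ : ∀ {a} {A : Set a} {xs ys : List A} → Unique xs → Unique ys →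
               (∀ {x} → x ∈ˡ xs ⇔ x ∈ˡ ys) → xs ↭ ys
unique∧set⇒↭ xs! ys! xs≐ys = ∼bag⇒↭ (unique∧set⇒bag xs! ys! xs≐ys)

length-allFin : ∀ m → length (allFin m) ≡ m
length-allFin m = length-tabulate id

length-cartesianProductWith : ∀ {a b c} {A : Set a} {B : Set b} {C : Set c} (f : A → B → C) xs ys →
                              length (cartesianProductWith f xs ys) ≡ length xs * length ys
length-cartesianProductWith f []       ys = refl
length-cartesianProductWith f (x ∷ xs) ys = begin
  length (map (f x) ys ++ cartesianProductWith f xs ys)
    ≡⟨ length-++ (map (f x) ys) ⟩
  length (map (f x) ys) + length (cartesianProductWith f xs ys)
    ≡⟨ cong₂ _+_ (length-map (f x) ys) (length-cartesianProductWith f xs ys) ⟩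
  length ys + length xs * length ys ∎

sum-map-const : ∀ {a} {A : Set a} (f : A → ℕ) {c} → (∀ x → f x ≡ c) → ∀ xs →
                sum (map f xs) ≡ length xs * c
sum-map-const f f≡c []       = refl
sum-map-const f f≡c (x ∷ xs) = cong₂ _+_ (f≡c x) (sum-map-const f f≡c xs)

module _ {a ℓ} {A : Set a} {Q : Pred A ℓ} (Q? : Decidable Q) where

  length-filter-++ : ∀ xs ys → length (filter Q? (xs ++ ys)) ≡ length (filter Q? xs) + length (filter Q? ys)
  length-filter-++ xs ys = trans (cong length (filter-++ Q? xs ys)) (length-++ (filter Q? xs))

  length-filter-map : ∀ {b} {B : Set b} (f : B → A) xs →
                      length (filter Q? (map f xs)) ≡ length (filter (Q? ∘ f) xs)
  length-filter-map f []       = refl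
  length-filter-map f (x ∷ xs) with does (Q? (f x))
  ... | true  = cong suc (length-filter-map f xs)
  ... | false = length-filter-map f xs

  length-filter-all : ∀ {xs} → All Q xs → length (filter Q? xs) ≡ length xs
  length-filter-all = cong length ∘ filter-all Q?

  length-filter-none : ∀ {xs} → All (∁ Q) xs → length (filter Q? xs) ≡ 0
  length-filter-none = cong length ∘ filter-none Q?

  length-filter-≡ : ∀ {x xs} → Unique xs → x ∈ˡ xs → (∀ {y} → Q y ⇔ y ≡ x) → length (filter Q? xs) ≡ 1
  length-filter-≡ (y∉ys ∷ ys!) (here refl) Q⇔≡x =
    cong length (trans (filter-accept Q? (from Q⇔≡x refl))
      (cong (_ ∷_) (filter-none Q? (All.map (λ y≢z Qz → y≢z (sym (to Q⇔≡x Qz))) y∉ys))))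
  length-filter-≡ (y∉ys ∷ ys!) (there x∈ys) Q⇔≡x =
    trans (cong length (filter-reject Q? (All.lookup y∉ys x∈ys ∘ to Q⇔≡x)))
          (length-filter-≡ ys! x∈ys Q⇔≡x)

  length-filter-≢ : ∀ {x xs} → Unique xs → x ∈ˡ xs → (∀ {y} → Q y ⇔ y ≢ x) →
                    suc (length (filter Q? xs)) ≡ length xs
  length-filter-≢ (y∉ys ∷ ys!) (here refl) Q⇔≢x =
    cong suc (trans (cong length (filter-reject Q? (λ Qy → to Q⇔≢x Qy refl)))
      (length-filter-all (All.map (λ y≢z → from Q⇔≢x (y≢z ∘ sym)) y∉ys)))
  length-filter-≢ (y∉ys ∷ ys!) (there x∈ys) Q⇔≢x =
    trans (cong (suc ∘ length) (filter-accept Q? (from Q⇔≢x (All.lookup y∉ys x∈ys))))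
          (cong suc (length-filter-≢ ys! x∈ys Q⇔≢x))

  length-filter-cartesianProductWith : ∀ {b c} {B : Set b} {C : Set c} (f : B → C → A) {k} xs ys →
    (∀ x → length (filter (Q? ∘ f x) ys) ≡ k) →
    length (filter Q? (cartesianProductWith f xs ys)) ≡ length xs * k
  length-filter-cartesianProductWith f     []       ys count = refl
  length-filter-cartesianProductWith f {k} (x ∷ xs) ys count = begin
    length (filter Q? (map (f x) ys ++ cartesianProductWith f xs ys))
      ≡⟨ length-filter-++ (map (f x) ys) _ ⟩
    length (filter Q? (map (f x) ys)) + length (filter Q? (cartesianProductWith f xs ys))
      ≡⟨ cong₂ _+_ (trans (length-filter-map (f x) ys) (count x))
                   (length-filter-cartesianProductWith f xs ys count) ⟩
    k + length xs * k ∎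

allSubsets-complete : ∀ {m} (p : Subset m) → p ∈ˡ allSubsets m
allSubsets-complete []                    = here refl
allSubsets-complete {suc m} (inside ∷ p)  = ∈-++⁺ˡ (∈-map⁺ (inside ∷_) (allSubsets-complete p))
allSubsets-complete {suc m} (outside ∷ p) =
  ∈-++⁺ʳ (map (inside ∷_) (allSubsets m)) (∈-map⁺ (outside ∷_) (allSubsets-complete p))

allSubsets-unique : ∀ m → Unique (allSubsets m)
allSubsets-unique zero    = [] ∷ []
allSubsets-unique (suc m) = Unique.++⁺ (Unique.map⁺ ∷-injectiveʳ (allSubsets-unique m))
                                       (Unique.map⁺ ∷-injectiveʳ (allSubsets-unique m)) disjoint
  where
  disjoint : ∀ {p} → ¬ (p ∈ˡ map (inside ∷_) (allSubsets m) × p ∈ˡ map (outside ∷_) (allSubsets m))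
  disjoint (p∈ , p∈′) with ∈-map⁻ (inside ∷_) p∈ | ∈-map⁻ (outside ∷_) p∈′
  ... | _ , _ , refl | _ , _ , ()

module _ {m : ℕ} where

  ∈-tabulate⇔ : ∀ {ℓ} {Q : Pred (Fin m) ℓ} (Q? : Decidable Q) {x} → x ∈ tabulate (does ∘ Q?) ⇔ Q x
  ∈-tabulate⇔ {Q = Q} Q? {x} = mk⇔ forward backward
    where
    forward : x ∈ tabulate (does ∘ Q?) → Q x
    forward x∈ with Q? x | trans (sym ([]=⇒lookup x∈)) (lookup∘tabulate (does ∘ Q?) x)
    ... | yes q | _  = q
    ... | no _  | ()
    backward : Q x → x ∈ tabulate (does ∘ Q?)
    backward q = lookup⇒[]= x _ (trans (lookup∘tabulate (does ∘ Q?) x) (dec-true (Q? x) q))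

  1<∣p∣⇒∃≢ : ∀ {p : Subset m} → 1 < ∣ p ∣ → ∀ y → ∃ λ x → x ≢ y × x ∈ p
  1<∣p∣⇒∃≢ {p} 1<∣p∣ y with any? (λ x → ¬? (x ≟ᶠ y) ×-dec (x ∈? p))
  ... | yes found = found
  ... | no ∄      = ⊥-elim (<⇒≱ 1<∣p∣ (subst (∣ p ∣ ≤_) (∣⁅x⁆∣≡1 y) (p⊆q⇒∣p∣≤∣q∣ p⊆⁅y⁆)))
    where
    p⊆⁅y⁆ : p ⊆ ⁅ y ⁆
    p⊆⁅y⁆ {x} x∈p with x ≟ᶠ y
    ... | yes refl = x∈⁅x⁆ y
    ... | no x≢y   = ⊥-elim (∄ (x , x≢y , x∈p))

  ∈∧∈∧≢⇒1<∣p∣ : ∀ {p : Subset m} {x y} → x ∈ p → y ∈ p → x ≢ y → 1 < ∣ p ∣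
  ∈∧∈∧≢⇒1<∣p∣ {p} {x} {y} x∈p y∈p x≢y = subst (_< ∣ p ∣) (∣⁅x⁆∣≡1 x)
    (p⊂q⇒∣p∣<∣q∣ ((λ z∈ → subst (_∈ p) (sym (x∈⁅y⁆⇒x≡y x z∈)) x∈p) ,
                   y , y∈p , λ y∈⁅x⁆ → x≢y (sym (x∈⁅y⁆⇒x≡y x y∈⁅x⁆))))

-- Subgroups of D_{2n}

module SubmonoidMod (m : ℕ) (R : ℕ → Set)
  (R-resp : ∀ a b → a % suc m ≡ b % suc m → R a → R b)
  (R-0 : R 0) (R-+ : ∀ {a b} → R a → R b → R (a + b)) where

  R-* : ∀ c {a} → R a → R (c * a)
  R-* zero    _  = R-0
  R-* (suc c) ra = R-+ ra (R-* c ra)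

  R-Bézout : ∀ {d a} → Bézout.Identity d a (suc m) → R a → R d
  R-Bézout {d} {a} (Bézout.+- x y eq) ra = R-resp (x * a) d x*a≡d (R-* x ra)
    where
    x*a≡d : x * a % suc m ≡ d % suc m
    x*a≡d = trans (cong (_% suc m) (sym eq)) ([m+kn]%n≡m%n d y (suc m))
  -- here x a ≡ -d, so (n - 1) x a ≡ d (mod n)
  R-Bézout {d} {a} (Bézout.-+ x y eq) ra = R-resp (m * x * a) d m*x*a≡d (R-* (m * x) ra)
    where
    m*x*a≡d : m * x * a % suc m ≡ d % suc m
    m*x*a≡d = begin
      m * x * a % suc m               ≡⟨ [m+kn]%n≡m%n (m * x * a) d (suc m) ⟨
      (m * x * a + d * suc m) % suc m ≡⟨ cong (_% suc m) multiplied ⟩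
      (d + m * y * suc m) % suc m     ≡⟨ [m+kn]%n≡m%n d (m * y) (suc m) ⟩
      d % suc m                       ∎
      where
      expand : ∀ m x a d → m * x * a + d * suc m ≡ d + m * (d + x * a)
      expand = solve-∀
      multiplied : m * x * a + d * suc m ≡ d + m * y * suc m
      multiplied = begin
        m * x * a + d * suc m ≡⟨ expand m x a d ⟩
        d + m * (d + x * a)   ≡⟨ cong (λ t → d + m * t) eq ⟩
        d + m * (y * suc m)   ≡⟨ cong (d +_) (*-assoc m y (suc m)) ⟨
        d + m * y * suc m     ∎

  R-gcd : ∀ {a} → R a → R (gcd a (suc m))
  R-gcd = R-Bézout (Bézout.identity (gcd-GCD _ _))

  R≐∣ : ∀ {d} → R d → (∀ j → R j → d ∣ j) → ∀ j → R j ⇔ d ∣ j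
  R≐∣ {d} rd R⊆ j = mk⇔ (R⊆ j) λ { (divides q refl) → R-* q rd }

module DihedralGroup (m : ℕ) where

  n : ℕ
  n = suc m

  e : D n
  e = inj₁ 0F

  mod-toℕ : ∀ (a : Fin n) → toℕ a mod n ≡ a
  mod-toℕ a = toℕ-injective (trans (toℕ-mod (toℕ a) n) (m<n⇒m%n≡m (toℕ<n a)))

  mod-cong : ∀ a b → a % n ≡ b % n → a mod n ≡ b mod n
  mod-cong a b eq = toℕ-injective (trans (toℕ-mod a n) (trans eq (sym (toℕ-mod b n))))

  %-absorbˡ : ∀ x y → (x % n + y) % n ≡ (x + y) % n
  %-absorbˡ x y = begin
    (x % n + y) % n         ≡⟨ %-distribˡ-+ (x % n) y n ⟩
    (x % n % n + y % n) % n ≡⟨ cong (λ t → (t + y % n) % n) (m%n%n≡m%n x n) ⟩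
    (x % n + y % n) % n     ≡⟨ %-distribˡ-+ x y n ⟨
    (x + y) % n             ∎

  %-absorbʳ : ∀ x y → (x + y % n) % n ≡ (x + y) % n
  %-absorbʳ x y = begin
    (x + y % n) % n ≡⟨ cong (_% n) (+-comm x (y % n)) ⟩
    (y % n + x) % n ≡⟨ %-absorbˡ y x ⟩
    (y + x) % n     ≡⟨ cong (_% n) (+-comm y x) ⟩
    (x + y) % n     ∎

  toℕ-⊕ : ∀ (a b : Fin n) → toℕ (a ⊕ b) ≡ (toℕ a + toℕ b) % n
  toℕ-⊕ a b = toℕ-mod (toℕ a + toℕ b) n

  toℕ-⊖ : ∀ (a b : Fin n) → toℕ (a ⊖ b) ≡ (toℕ a + (n ∸ toℕ b)) % n
  toℕ-⊖ a b = toℕ-mod (toℕ a + (n ∸ toℕ b)) n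

  mod-⊕ : ∀ a b → (a mod n) ⊕ (b mod n) ≡ (a + b) mod n
  mod-⊕ a b = mod-cong (toℕ (a mod n) + toℕ (b mod n)) (a + b) (begin
    (toℕ (a mod n) + toℕ (b mod n)) % n ≡⟨ cong₂ (λ u v → (u + v) % n) (toℕ-mod a n) (toℕ-mod b n) ⟩
    (a % n + b % n) % n                 ≡⟨ %-absorbˡ a (b % n) ⟩
    (a + b % n) % n                     ≡⟨ %-absorbʳ a b ⟩
    (a + b) % n                         ∎)

  ∸-cancel : ∀ (b : Fin n) → toℕ b + (n ∸ toℕ b) ≡ n
  ∸-cancel b = m+[n∸m]≡n (<⇒≤ (toℕ<n b))

  ⊖-⊕-cancel : ∀ (a b : Fin n) → (a ⊖ b) ⊕ b ≡ a
  ⊖-⊕-cancel a b = toℕ-injective (begin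
    toℕ ((a ⊖ b) ⊕ b)                       ≡⟨ toℕ-⊕ (a ⊖ b) b ⟩
    (toℕ (a ⊖ b) + toℕ b) % n               ≡⟨ cong (λ t → (t + toℕ b) % n) (toℕ-⊖ a b) ⟩
    ((toℕ a + (n ∸ toℕ b)) % n + toℕ b) % n ≡⟨ %-absorbˡ (toℕ a + (n ∸ toℕ b)) (toℕ b) ⟩
    (toℕ a + (n ∸ toℕ b) + toℕ b) % n       ≡⟨ cong (_% n) (+-assoc (toℕ a) (n ∸ toℕ b) (toℕ b)) ⟩
    (toℕ a + (n ∸ toℕ b + toℕ b)) % n       ≡⟨ cong (λ t → (toℕ a + t) % n) (m∸n+n≡m (<⇒≤ (toℕ<n b))) ⟩
    (toℕ a + n) % n                         ≡⟨ [m+n]%n≡m%n (toℕ a) n ⟩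
    toℕ a % n                               ≡⟨ m<n⇒m%n≡m (toℕ<n a) ⟩
    toℕ a                                   ∎)

  mulD-invD : ∀ x → mulD x (invD x) ≡ e
  mulD-invD (inj₁ a) = cong inj₁ (toℕ-injective (begin
    toℕ (a ⊕ (0F ⊖ a))            ≡⟨ toℕ-⊕ a (0F ⊖ a) ⟩
    (toℕ a + toℕ (0F ⊖ a)) % n    ≡⟨ cong (λ t → (toℕ a + t) % n) (toℕ-⊖ 0F a) ⟩
    (toℕ a + (n ∸ toℕ a) % n) % n ≡⟨ %-absorbʳ (toℕ a) (n ∸ toℕ a) ⟩
    (toℕ a + (n ∸ toℕ a)) % n     ≡⟨ cong (_% n) (∸-cancel a) ⟩
    n % n                         ≡⟨ n%n≡0 n ⟩
    0                             ∎))
  mulD-invD (inj₂ a) = cong inj₁ (toℕ-injective (begin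
    toℕ (a ⊖ a)               ≡⟨ toℕ-⊖ a a ⟩
    (toℕ a + (n ∸ toℕ a)) % n ≡⟨ cong (_% n) (∸-cancel a) ⟩
    n % n                     ≡⟨ n%n≡0 n ⟩
    0                         ∎))

  record IsSubgroupᴰ (M : D n → Set) : Set where
    field
      nonempty  : ∃ M
      ∙-closed  : ∀ {x y} → M x → M y → M (mulD x y)
      ⁻¹-closed : ∀ {x} → M x → M (invD x)

    e∈ : M e
    e∈ = let (x , x∈) = nonempty in subst M (mulD-invD x) (∙-closed x∈ (⁻¹-closed x∈))

    r^_∈ : ℕ → Set
    r^ j ∈ = M (inj₁ (j mod n))

    r^-resp : ∀ a b → a % n ≡ b % n → r^ a ∈ → r^ b ∈
    r^-resp a b eq = subst (λ t → M (inj₁ t)) (mod-cong a b eq)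

    r^-+ : ∀ {a b} → r^ a ∈ → r^ b ∈ → r^ (a + b) ∈
    r^-+ {a} {b} ra rb = subst (λ t → M (inj₁ t)) (mod-⊕ a b) (∙-closed ra rb)

    open SubmonoidMod m r^_∈ r^-resp e∈ (λ {a} {b} → r^-+ {a} {b}) public

    rotation∈⇔ : ∀ {a} → M (inj₁ a) ⇔ r^ toℕ a ∈
    rotation∈⇔ {a} = mk⇔ (subst (λ t → M (inj₁ t)) (sym (mod-toℕ a)))
                         (subst (λ t → M (inj₁ t)) (mod-toℕ a))

    reflection∈⇔ : ∀ {b c} → M (inj₂ b) → M (inj₂ c) ⇔ r^ (toℕ c + (n ∸ toℕ b)) ∈
    reflection∈⇔ {b} {c} b∈ = mk⇔ (λ c∈ → ∙-closed c∈ b∈)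
      (λ r∈ → subst (λ t → M (inj₂ t)) (⊖-⊕-cancel c b) (∙-closed r∈ b∈))

  join-injective : ∀ {x y : D n} → join n n x ≡ join n n y → x ≡ y
  join-injective {x} {y} eq =
    trans (sym (splitAt-join n n x)) (trans (cong (splitAt n) eq) (splitAt-join n n y))

  toSubset : ∀ {M : D n → Set} → Decidable M → Subset (n + n)
  toSubset M? = tabulate (does ∘ M? ∘ splitAt n)

  module _ {M : D n → Set} (M? : Decidable M) where

    ∈toSubset⇔ : ∀ {x} → x ∈ toSubset M? ⇔ M (splitAt n x)
    ∈toSubset⇔ = ∈-tabulate⇔ (M? ∘ splitAt n)

    join∈toSubset⇔ : ∀ {x} → join n n x ∈ toSubset M? ⇔ M x
    join∈toSubset⇔ {x} = subst (λ t → join n n x ∈ toSubset M? ⇔ M t) (splitAt-join n n x) ∈toSubset⇔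

    toSubset-isSubgroup : IsSubgroupᴰ M → IsSubgroup n (toSubset M?)
    toSubset-isSubgroup M-sub =
        (join n n e , from join∈toSubset⇔ e∈)
      , (λ x y x∈ y∈ → from ∈toSubset⇔ (subst M (sym (splitAt-join n n _))
          (∙-closed (to ∈toSubset⇔ x∈) (to ∈toSubset⇔ y∈))))
      , (λ x x∈ → from ∈toSubset⇔ (subst M (sym (splitAt-join n n _)) (⁻¹-closed (to ∈toSubset⇔ x∈))))
      where open IsSubgroupᴰ M-sub

    ≡toSubset : ∀ {H} → (∀ x → join n n x ∈ H ⇔ M x) → H ≡ toSubset M?
    ≡toSubset {H} H≐M = ⊆-antisym
      (λ {y} y∈ → from ∈toSubset⇔ (to (H≐M (splitAt n y)) (subst (_∈ H) (sym (join-splitAt n n y)) y∈)))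
      (λ {y} y∈ → subst (_∈ H) (join-splitAt n n y) (from (H≐M (splitAt n y)) (to ∈toSubset⇔ y∈)))

  subgroupᴰ-of : ∀ {H} → IsSubgroup n H → IsSubgroupᴰ (λ x → join n n x ∈ H)
  subgroupᴰ-of {H} ((y , y∈) , ∙-closed , ⁻¹-closed) = record
    { nonempty  = splitAt n y , subst (_∈ H) (sym (join-splitAt n n y)) y∈
    ; ∙-closed  = λ {x} {y} x∈ y∈ → subst (_∈ H)
        (cong₂ (λ u v → join n n (mulD u v)) (splitAt-join n n x) (splitAt-join n n y))
        (∙-closed _ _ x∈ y∈)
    ; ⁻¹-closed = λ {x} x∈ → subst (_∈ H) (cong (join n n ∘ invD) (splitAt-join n n x)) (⁻¹-closed _ x∈)
    }

  -- Standard d nothing is ⟨r^d⟩ and Standard d (just b) is ⟨r^d, r^b s⟩, which contains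
  -- r^c s iff c ≡ b (mod d).
  Standard : (d : ℕ) .{{_ : NonZero d}} → Maybe ℕ → D n → Set
  Standard d _        (inj₁ a) = d ∣ toℕ a
  Standard d nothing  (inj₂ _) = ⊥
  Standard d (just b) (inj₂ c) = toℕ c % d ≡ b % d

  standard? : ∀ d .{{_ : NonZero d}} ρ → Decidable (Standard d ρ)
  standard? d _        (inj₁ a) = d ∣? toℕ a
  standard? d nothing  (inj₂ _) = no λ ()
  standard? d (just b) (inj₂ c) = toℕ c % d ≟ b % d

  module _ {d} .{{_ : NonZero d}} (d∣n : d ∣ n) where

    ∣-⊕ : ∀ {a b} → d ∣ toℕ a → d ∣ toℕ b → d ∣ toℕ (a ⊕ b)
    ∣-⊕ {a} {b} d∣a d∣b = subst (d ∣_) (sym (toℕ-⊕ a b)) (%-presˡ-∣ (∣m∣n⇒∣m+n d∣a d∣b) d∣n)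

    ∣-⊖ : ∀ {a b} → toℕ a % d ≡ toℕ b % d → d ∣ toℕ (a ⊖ b)
    ∣-⊖ {a} {b} a≡b = subst (d ∣_) (sym (toℕ-⊖ a b))
      (%-presˡ-∣ (from (∣+∸⇔%≡% d∣n (<⇒≤ (toℕ<n b))) a≡b) d∣n)

    ⊕-residue : ∀ {a c} → d ∣ toℕ a → toℕ (a ⊕ c) % d ≡ toℕ c % d
    ⊕-residue {a} {c} d∣a = begin
      toℕ (a ⊕ c) % d         ≡⟨ cong (_% d) (toℕ-⊕ a c) ⟩
      (toℕ a + toℕ c) % n % d ≡⟨ m∣n⇒o%n%m≡o%m d n _ d∣n ⟩
      (toℕ a + toℕ c) % d     ≡⟨ %-remove-+ˡ (toℕ c) d∣a ⟩
      toℕ c % d               ∎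

    ⊖-residue : ∀ {a c} → d ∣ toℕ a → toℕ (c ⊖ a) % d ≡ toℕ c % d
    ⊖-residue {a} {c} d∣a = begin
      toℕ (c ⊖ a) % d               ≡⟨ cong (_% d) (toℕ-⊖ c a) ⟩
      (toℕ c + (n ∸ toℕ a)) % n % d ≡⟨ m∣n⇒o%n%m≡o%m d n _ d∣n ⟩
      (toℕ c + (n ∸ toℕ a)) % d     ≡⟨ %-remove-+ʳ (toℕ c) (∣n∸ d∣n (<⇒≤ (toℕ<n a)) d∣a) ⟩
      toℕ c % d                     ∎

    Standard-isSubgroupᴰ : ∀ ρ → IsSubgroupᴰ (Standard d ρ)
    Standard-isSubgroupᴰ ρ = record
      { nonempty  = e , (d ∣0)
      ; ∙-closed  = λ {x} {y} → ∙-closed ρ x y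
      ; ⁻¹-closed = λ {x} → ⁻¹-closed ρ x
      }
      where
      ∙-closed : ∀ ρ x y → Standard d ρ x → Standard d ρ y → Standard d ρ (mulD x y)
      ∙-closed ρ        (inj₁ a) (inj₁ b)  d∣a d∣b   = ∣-⊕ d∣a d∣b
      ∙-closed (just b) (inj₁ a) (inj₂ c)  d∣a c≡b   = trans (⊕-residue d∣a) c≡b
      ∙-closed (just b) (inj₂ c) (inj₁ a)  c≡b d∣a   = trans (⊖-residue d∣a) c≡b
      ∙-closed (just b) (inj₂ c) (inj₂ c′) c≡b c′≡b = ∣-⊖ (trans c≡b (sym c′≡b))
      ⁻¹-closed : ∀ ρ x → Standard d ρ x → Standard d ρ (invD x)
      ⁻¹-closed ρ        (inj₁ a) d∣a = ∣-⊖ {0F} (trans (n∣m⇒m%n≡0 0 d (d ∣0)) (sym (n∣m⇒m%n≡0 (toℕ a) d d∣a)))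
      ⁻¹-closed (just b) (inj₂ c) c≡b = c≡b

  Standard-just-resp : ∀ {d} .{{_ : NonZero d}} {b b′} → b % d ≡ b′ % d →
                       ∀ x → Standard d (just b) x ⇔ Standard d (just b′) x
  Standard-just-resp b≡b′ (inj₁ a) = mk⇔ id id
  Standard-just-resp b≡b′ (inj₂ c) = mk⇔ (λ c≡b → trans c≡b b≡b′) (λ c≡b′ → trans c≡b′ (sym b≡b′))

  Standard-1-universal : ∀ {b} x → Standard 1 (just b) x
  Standard-1-universal     (inj₁ a) = 1∣ toℕ a
  Standard-1-universal {b} (inj₂ c) = trans (n%1≡0 (toℕ c)) (sym (n%1≡0 b))

  n∣⇒≡e : ∀ {a} → n ∣ toℕ a → inj₁ a ≡ e
  n∣⇒≡e {a} n∣a = cong inj₁ (toℕ%-injective (n∣m⇒m%n≡0 (toℕ a) n n∣a))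

  Standard-n-trivial : ∀ x → Standard n nothing x → x ≡ e
  Standard-n-trivial (inj₁ a) = n∣⇒≡e

  module _ {M} (M-sub : IsSubgroupᴰ M) {d} .{{_ : NonZero d}} (d∣n : d ∣ n) where
    open IsSubgroupᴰ M-sub

    ≐Standard-nothing : (∀ j → r^ j ∈ ⇔ d ∣ j) → (∀ c → ¬ M (inj₂ c)) →
                        ∀ x → M x ⇔ Standard d nothing x
    ≐Standard-nothing r^∈⇔ no-reflection (inj₁ a) = ⇔-trans rotation∈⇔ (r^∈⇔ (toℕ a))
    ≐Standard-nothing r^∈⇔ no-reflection (inj₂ c) = mk⇔ (no-reflection c) ⊥-elim

    ≐Standard-just : (∀ j → r^ j ∈ ⇔ d ∣ j) → ∀ {b} → M (inj₂ b) →
                     ∀ x → M x ⇔ Standard d (just (toℕ b)) x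
    ≐Standard-just r^∈⇔     b∈ (inj₁ a) = ⇔-trans rotation∈⇔ (r^∈⇔ (toℕ a))
    ≐Standard-just r^∈⇔ {b} b∈ (inj₂ c) =
      ⇔-trans (reflection∈⇔ b∈) (⇔-trans (r^∈⇔ _) (∣+∸⇔%≡% d∣n (<⇒≤ (toℕ<n b))))

-- The intersection graph of D_{2p²}

module DihedralOfOrder2p² (k : ℕ) where

  P : ℕ
  P = suc (suc k)

  open DihedralGroup (Data.Nat.pred (P * P)) public

  P∣n : P ∣ n
  P∣n = divides P refl

  module _ (p-prime : Prime P) {M} (M? : Decidable M) (M-sub : IsSubgroupᴰ M) where
    open IsSubgroupᴰ M-sub

    r¹∈ : ∀ {a} → M (inj₁ a) → ¬ P ∣ toℕ a → r^ 1 ∈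
    r¹∈ {a} a∈ P∤a = subst r^_∈ (coprime⇒gcd≡1 (coprime-* a⊥P a⊥P)) (R-gcd {toℕ a} (to rotation∈⇔ a∈))
      where a⊥P = prime∤⇒coprime p-prime P∤a

    rᵖ∈ : ∀ {a} → M (inj₁ a) → a ≢ 0F → P ∣ toℕ a → r^ P ∈
    rᵖ∈ {a} a∈ a≢0 (divides u a≡uP) = subst r^_∈ gcd≡P (R-gcd {toℕ a} (to rotation∈⇔ a∈))
      where
      u<P : u < P
      u<P = *-cancelʳ-< P u P (subst (_< n) a≡uP (toℕ<n a))
      u≢0 : u ≢ 0
      u≢0 refl = a≢0 (toℕ-injective a≡uP)
      gcd≡P : gcd (toℕ a) n ≡ P
      gcd≡P = trans (cong (λ t → gcd t n) a≡uP) (gcd[u*p,p*p]≡p p-prime u≢0 u<P)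

    P∣exponents : ¬ (∃ λ a → M (inj₁ a) × ¬ P ∣ toℕ a) → ∀ j → r^ j ∈ → P ∣ j
    P∣exponents ∄ j r^j∈ = ∣n∣m%n⇒∣m P∣n (subst (P ∣_) (toℕ-mod j n)
      (decidable-stable (P ∣? _) λ P∤ → ∄ (j mod n , r^j∈ , P∤)))

    n∣exponents : ¬ (∃ λ a → M (inj₁ a) × a ≢ 0F) → ∀ j → r^ j ∈ → n ∣ j
    n∣exponents ∄ j r^j∈ = m%n≡0⇒n∣m j n (trans (sym (toℕ-mod j n))
      (cong toℕ (decidable-stable (j mod n ≟ᶠ 0F) λ j≢0 → ∄ (j mod n , r^j∈ , j≢0))))

    rotation-exponents : (∀ j → r^ j ∈ ⇔ 1 ∣ j) ⊎ (∀ j → r^ j ∈ ⇔ P ∣ j) ⊎ (∀ j → r^ j ∈ ⇔ n ∣ j)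
    rotation-exponents with any? (λ a → M? (inj₁ a) ×-dec ¬? (P ∣? toℕ a))
    ... | yes (a , a∈ , P∤a) = inj₁ (R≐∣ (r¹∈ a∈ P∤a) (λ j _ → 1∣ j))
    ... | no ∄ with any? (λ a → M? (inj₁ a) ×-dec ¬? (a ≟ᶠ 0F))
    ...   | yes (a , a∈ , a≢0) =
      inj₂ (inj₁ (R≐∣ (rᵖ∈ a∈ a≢0 (P∣exponents ∄ (toℕ a) (to rotation∈⇔ a∈))) (P∣exponents ∄)))
    ...   | no ∄′ = inj₂ (inj₂ (R≐∣ (r^-resp 0 n (sym (n%n≡0 n)) e∈) (n∣exponents ∄′)))

  data Code : Set where
    ⟨r⟩ ⟨rᵖ⟩ : Code
    ⟨rᵖ,rⁱs⟩ : Fin P → Code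
    ⟨rᵇs⟩    : Fin n → Code

  _∋_ : Code → D n → Set
  ⟨r⟩        ∋ x = Standard 1 nothing x
  ⟨rᵖ⟩       ∋ x = Standard P nothing x
  ⟨rᵖ,rⁱs⟩ i ∋ x = Standard P (just (toℕ i)) x
  ⟨rᵇs⟩ b    ∋ x = Standard n (just (toℕ b)) x

  _∋?_ : ∀ σ → Decidable (σ ∋_)
  ⟨r⟩        ∋? x = standard? 1 nothing x
  ⟨rᵖ⟩       ∋? x = standard? P nothing x
  ⟨rᵖ,rⁱs⟩ i ∋? x = standard? P (just (toℕ i)) x
  ⟨rᵇs⟩ b    ∋? x = standard? n (just (toℕ b)) x

  ∋-isSubgroupᴰ : ∀ σ → IsSubgroupᴰ (σ ∋_)
  ∋-isSubgroupᴰ ⟨r⟩          = Standard-isSubgroupᴰ (1∣ n) nothing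
  ∋-isSubgroupᴰ ⟨rᵖ⟩         = Standard-isSubgroupᴰ P∣n nothing
  ∋-isSubgroupᴰ (⟨rᵖ,rⁱs⟩ i) = Standard-isSubgroupᴰ P∣n (just (toℕ i))
  ∋-isSubgroupᴰ (⟨rᵇs⟩ b)    = Standard-isSubgroupᴰ ∣-refl (just (toℕ b))

  classify : Prime P → ∀ {M} → Decidable M → IsSubgroupᴰ M →
             (∃ λ x → ¬ M x) → (∃ λ x → x ≢ e × M x) → ∃ λ σ → ∀ x → M x ⇔ σ ∋ x
  classify p-prime M? M-sub (x , x∉) (y , y≢e , y∈)
    with rotation-exponents p-prime M? M-sub | any? (λ b → M? (inj₂ b))
  ... | inj₁ R≐1ℕ | no ∄ = ⟨r⟩ , ≐Standard-nothing M-sub (1∣ n) R≐1ℕ (λ c c∈ → ∄ (c , c∈))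
  ... | inj₁ R≐1ℕ | yes (b , b∈) =
    ⊥-elim (x∉ (from (≐Standard-just M-sub (1∣ n) R≐1ℕ b∈ x) (Standard-1-universal x)))
  ... | inj₂ (inj₁ R≐Pℕ) | no ∄ = ⟨rᵖ⟩ , ≐Standard-nothing M-sub P∣n R≐Pℕ (λ c c∈ → ∄ (c , c∈))
  ... | inj₂ (inj₁ R≐Pℕ) | yes (b , b∈) = ⟨rᵖ,rⁱs⟩ (toℕ b mod P) , λ x →
    ⇔-trans (≐Standard-just M-sub P∣n R≐Pℕ b∈ x) (Standard-just-resp (sym (toℕ-mod-% (toℕ b) P)) x)
  ... | inj₂ (inj₂ R≐nℕ) | no ∄ = ⊥-elim (y≢e (Standard-n-trivial y
    (to (≐Standard-nothing M-sub ∣-refl R≐nℕ (λ c c∈ → ∄ (c , c∈)) y) y∈)))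
  ... | inj₂ (inj₂ R≐nℕ) | yes (b , b∈) = ⟨rᵇs⟩ b , ≐Standard-just M-sub ∣-refl R≐nℕ b∈

  ⟦_⟧ : Code → Subset (n + n)
  ⟦ σ ⟧ = toSubset (σ ∋?_)

  join∈⟦⟧⇔ : ∀ σ {x} → join n n x ∈ ⟦ σ ⟧ ⇔ σ ∋ x
  join∈⟦⟧⇔ σ = join∈toSubset⇔ (σ ∋?_)

  1<P : 1 < P
  1<P = s≤s (s≤s z≤n)

  P<n : P < n
  P<n = m<m*n P P 1<P

  1<n : 1 < n
  1<n = <-trans 1<P P<n

  r¹ rᵖ : D n
  r¹ = inj₁ (fromℕ< 1<n)
  rᵖ = inj₁ (fromℕ< P<n)

  rⁱs : Fin P → D n
  rⁱs i = inj₂ (fromℕ< (<-trans (toℕ<n i) P<n))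

  ∣rᵖ : ∀ {d} → d ∣ P → d ∣ toℕ (fromℕ< P<n)
  ∣rᵖ {d} = subst (d ∣_) (sym (toℕ-fromℕ< P<n))

  rᵖ≢e : rᵖ ≢ e
  rᵖ≢e = 1+n≢0 ∘ trans (sym (toℕ-fromℕ< P<n)) ∘ cong toℕ ∘ inj₁-injective

  n∤P : ¬ n ∣ toℕ (fromℕ< P<n)
  n∤P = >⇒∤ P<n ∘ subst (n ∣_) (toℕ-fromℕ< P<n)

  rⁱs∈⇔ : ∀ i j → ⟨rᵖ,rⁱs⟩ j ∋ rⁱs i ⇔ i ≡ j
  rⁱs∈⇔ i j = mk⇔ (λ i≡j → toℕ%-injective (trans (cong (_% P) (sym toℕ-i)) i≡j))
                  (λ { refl → cong (_% P) toℕ-i })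
    where
    toℕ-i : toℕ (fromℕ< (<-trans (toℕ<n i) P<n)) ≡ toℕ i
    toℕ-i = toℕ-fromℕ< (<-trans (toℕ<n i) P<n)

  r¹∈⇒≡⟨r⟩ : ∀ σ → σ ∋ r¹ → σ ≡ ⟨r⟩
  r¹∈⇒≡⟨r⟩ ⟨r⟩          _  = refl
  r¹∈⇒≡⟨r⟩ ⟨rᵖ⟩         P∣ = ⊥-elim (>⇒∤ 1<P (subst (P ∣_) (toℕ-fromℕ< 1<n) P∣))
  r¹∈⇒≡⟨r⟩ (⟨rᵖ,rⁱs⟩ _) P∣ = ⊥-elim (>⇒∤ 1<P (subst (P ∣_) (toℕ-fromℕ< 1<n) P∣))
  r¹∈⇒≡⟨r⟩ (⟨rᵇs⟩ _)    n∣ = ⊥-elim (>⇒∤ 1<n (subst (n ∣_) (toℕ-fromℕ< 1<n) n∣))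

  ∋-injective : ∀ {σ τ} → (∀ x → σ ∋ x ⇔ τ ∋ x) → σ ≡ τ
  ∋-injective {⟨r⟩}        {τ}          σ≐τ = sym (r¹∈⇒≡⟨r⟩ τ (to (σ≐τ r¹) (1∣ _)))
  ∋-injective {σ}          {⟨r⟩}        σ≐τ = r¹∈⇒≡⟨r⟩ σ (from (σ≐τ r¹) (1∣ _))
  ∋-injective {⟨rᵖ⟩}       {⟨rᵖ⟩}       σ≐τ = refl
  ∋-injective {⟨rᵖ⟩}       {⟨rᵖ,rⁱs⟩ i} σ≐τ = ⊥-elim (from (σ≐τ (rⁱs i)) (from (rⁱs∈⇔ i i) refl))
  ∋-injective {⟨rᵖ⟩}       {⟨rᵇs⟩ b}    σ≐τ = ⊥-elim (from (σ≐τ (inj₂ b)) refl)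
  ∋-injective {⟨rᵖ,rⁱs⟩ i} {⟨rᵖ⟩}       σ≐τ = ⊥-elim (to (σ≐τ (rⁱs i)) (from (rⁱs∈⇔ i i) refl))
  ∋-injective {⟨rᵖ,rⁱs⟩ i} {⟨rᵖ,rⁱs⟩ j} σ≐τ =
    cong ⟨rᵖ,rⁱs⟩ (to (rⁱs∈⇔ i j) (to (σ≐τ (rⁱs i)) (from (rⁱs∈⇔ i i) refl)))
  ∋-injective {⟨rᵖ,rⁱs⟩ i} {⟨rᵇs⟩ b}    σ≐τ = ⊥-elim (n∤P (to (σ≐τ rᵖ) (∣rᵖ ∣-refl)))
  ∋-injective {⟨rᵇs⟩ b}    {⟨rᵖ⟩}       σ≐τ = ⊥-elim (to (σ≐τ (inj₂ b)) refl)
  ∋-injective {⟨rᵇs⟩ b}    {⟨rᵖ,rⁱs⟩ i} σ≐τ = ⊥-elim (n∤P (from (σ≐τ rᵖ) (∣rᵖ ∣-refl)))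
  ∋-injective {⟨rᵇs⟩ b}    {⟨rᵇs⟩ c}    σ≐τ = cong ⟨rᵇs⟩ (toℕ%-injective (to (σ≐τ (inj₂ b)) refl))

  ⟦⟧-injective : ∀ {σ τ} → ⟦ σ ⟧ ≡ ⟦ τ ⟧ → σ ≡ τ
  ⟦⟧-injective {σ} {τ} ⟦σ⟧≡⟦τ⟧ = ∋-injective λ x →
    ⇔-trans (⇔-sym (join∈⟦⟧⇔ σ)) (subst (λ H → join n n x ∈ H ⇔ τ ∋ x) (sym ⟦σ⟧≡⟦τ⟧) (join∈⟦⟧⇔ τ))

  outsider : Code → D n
  outsider ⟨r⟩  = inj₂ 0F
  outsider ⟨rᵖ⟩ = inj₂ 0F
  outsider _    = r¹

  outsider∉ : ∀ σ → ¬ σ ∋ outsider σ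
  outsider∉ ⟨r⟩          ()
  outsider∉ ⟨rᵖ⟩         ()
  outsider∉ (⟨rᵖ,rⁱs⟩ i) r¹∈ with () ← r¹∈⇒≡⟨r⟩ (⟨rᵖ,rⁱs⟩ i) r¹∈
  outsider∉ (⟨rᵇs⟩ b)    r¹∈ with () ← r¹∈⇒≡⟨r⟩ (⟨rᵇs⟩ b) r¹∈

  nonidentity : Code → D n
  nonidentity (⟨rᵇs⟩ b) = inj₂ b
  nonidentity _         = rᵖ

  nonidentity≢e : ∀ σ → nonidentity σ ≢ e
  nonidentity≢e ⟨r⟩          = rᵖ≢e
  nonidentity≢e ⟨rᵖ⟩         = rᵖ≢e
  nonidentity≢e (⟨rᵖ,rⁱs⟩ _) = rᵖ≢e
  nonidentity≢e (⟨rᵇs⟩ _)    = λ ()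

  nonidentity∈ : ∀ σ → σ ∋ nonidentity σ
  nonidentity∈ ⟨r⟩          = 1∣ _
  nonidentity∈ ⟨rᵖ⟩         = ∣rᵖ ∣-refl
  nonidentity∈ (⟨rᵖ,rⁱs⟩ _) = ∣rᵖ ∣-refl
  nonidentity∈ (⟨rᵇs⟩ _)    = refl

  e∈⟦⟧ : ∀ σ → join n n e ∈ ⟦ σ ⟧
  e∈⟦⟧ σ = from (join∈⟦⟧⇔ σ) (IsSubgroupᴰ.e∈ (∋-isSubgroupᴰ σ))

  ⟦⟧-isVertex : ∀ σ → IsVertex n ⟦ σ ⟧
  ⟦⟧-isVertex σ =
      toSubset-isSubgroup (σ ∋?_) (∋-isSubgroupᴰ σ)
    , (join n n (outsider σ) , outsider∉ σ ∘ to (join∈⟦⟧⇔ σ))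
    , ∈∧∈∧≢⇒1<∣p∣ (e∈⟦⟧ σ) (from (join∈⟦⟧⇔ σ) (nonidentity∈ σ)) (nonidentity≢e σ ∘ sym ∘ join-injective)

  vertex⇒≡⟦⟧ : Prime P → ∀ {H} → IsVertex n H → ∃ λ σ → H ≡ ⟦ σ ⟧
  vertex⇒≡⟦⟧ p-prime {H} (H-sub , (x , x∉H) , 1<∣H∣) =
    let (y , y≢e , y∈H) = 1<∣p∣⇒∃≢ 1<∣H∣ (join n n e)
        (σ , H≐σ)       = classify p-prime (λ z → join n n z ∈? H) (subgroupᴰ-of H-sub)
          (splitAt n x , x∉H ∘ subst (_∈ H) (join-splitAt n n x))
          (splitAt n y , (y≢e ∘ trans (sym (join-splitAt n n y)) ∘ cong (join n n)) ,
            subst (_∈ H) (sym (join-splitAt n n y)) y∈H)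
    in σ , ≡toSubset (σ ∋?_) H≐σ

  Share : Code → Code → Set
  Share σ τ = ∃ λ x → x ≢ e × σ ∋ x × τ ∋ x

  _∼_ : Code → Code → Set
  σ ∼ τ = Adjacent ⟦ σ ⟧ ⟦ τ ⟧

  _∼?_ : ∀ σ τ → Dec (σ ∼ τ)
  σ ∼? τ = adjacent? ⟦ σ ⟧ ⟦ τ ⟧

  ∼⇔≢×Share : ∀ σ τ → σ ∼ τ ⇔ (σ ≢ τ × Share σ τ)
  ∼⇔≢×Share σ τ = mk⇔ forward backward
    where
    forward : σ ∼ τ → σ ≢ τ × Share σ τ
    forward (⟦σ⟧≢⟦τ⟧ , 1<∣∩∣) =
      let (x , x≢e , x∈∩) = 1<∣p∣⇒∃≢ 1<∣∩∣ (join n n e)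
          (x∈σ , x∈τ)     = x∈p∩q⁻ ⟦ σ ⟧ ⟦ τ ⟧ x∈∩
      in (⟦σ⟧≢⟦τ⟧ ∘ cong ⟦_⟧) , splitAt n x , (x≢e ∘ trans (sym (join-splitAt n n x)) ∘ cong (join n n)) ,
         to (∈toSubset⇔ (σ ∋?_)) x∈σ , to (∈toSubset⇔ (τ ∋?_)) x∈τ
    backward : σ ≢ τ × Share σ τ → σ ∼ τ
    backward (σ≢τ , x , x≢e , x∈σ , x∈τ) = (σ≢τ ∘ ⟦⟧-injective) ,
      ∈∧∈∧≢⇒1<∣p∣ (x∈p∩q⁺ (e∈⟦⟧ σ , e∈⟦⟧ τ)) (x∈p∩q⁺ (from (join∈⟦⟧⇔ σ) x∈σ , from (join∈⟦⟧⇔ τ) x∈τ))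
                  (x≢e ∘ sym ∘ join-injective)

  ∼-irrefl : ∀ σ → ¬ σ ∼ σ
  ∼-irrefl σ (⟦σ⟧≢⟦σ⟧ , _) = ⟦σ⟧≢⟦σ⟧ refl

  ∼-sym : ∀ σ τ → σ ∼ τ → τ ∼ σ
  ∼-sym σ τ σ∼τ = let (σ≢τ , x , x≢e , x∈σ , x∈τ) = to (∼⇔≢×Share σ τ) σ∼τ
                  in from (∼⇔≢×Share τ σ) ((σ≢τ ∘ sym) , x , x≢e , x∈τ , x∈σ)

  ∼-via-rᵖ : ∀ σ τ → σ ≢ τ → σ ∋ rᵖ → τ ∋ rᵖ → σ ∼ τ
  ∼-via-rᵖ σ τ σ≢τ rᵖ∈σ rᵖ∈τ = from (∼⇔≢×Share σ τ) (σ≢τ , rᵖ , rᵖ≢e , rᵖ∈σ , rᵖ∈τ)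

  ⟨rᵇs⟩∼⇔ : ∀ b τ → ⟨rᵇs⟩ b ∼ τ ⇔ (⟨rᵇs⟩ b ≢ τ × τ ∋ inj₂ b)
  ⟨rᵇs⟩∼⇔ b τ = mk⇔
    (λ b∼τ → let (b≢τ , x , x≢e , x∈b , x∈τ) = to (∼⇔≢×Share (⟨rᵇs⟩ b) τ) b∼τ
             in b≢τ , subst (τ ∋_) (only-reflection x x≢e x∈b) x∈τ)
    (λ (b≢τ , b∈τ) → from (∼⇔≢×Share (⟨rᵇs⟩ b) τ) (b≢τ , inj₂ b , (λ ()) , refl , b∈τ))
    where
    only-reflection : ∀ x → x ≢ e → ⟨rᵇs⟩ b ∋ x → x ≡ inj₂ b
    only-reflection (inj₁ a) x≢e n∣a = ⊥-elim (x≢e (n∣⇒≡e n∣a))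
    only-reflection (inj₂ c) x≢e c≡b = cong inj₂ (toℕ%-injective c≡b)

  ⟨rᵇs⟩∼⟨rᵖ,rⁱs⟩⇔ : ∀ b i → ⟨rᵇs⟩ b ∼ ⟨rᵖ,rⁱs⟩ i ⇔ toℕ b % P ≡ toℕ i % P
  ⟨rᵇs⟩∼⟨rᵖ,rⁱs⟩⇔ b i = mk⇔ (proj₂ ∘ to (⟨rᵇs⟩∼⇔ b (⟨rᵖ,rⁱs⟩ i)))
                            (λ b≡i → from (⟨rᵇs⟩∼⇔ b (⟨rᵖ,rⁱs⟩ i)) ((λ ()) , b≡i))

  ⟨rᵇs⟩≁ : ∀ b τ → ¬ τ ∋ inj₂ b → ¬ ⟨rᵇs⟩ b ∼ τ
  ⟨rᵇs⟩≁ b τ b∉τ = b∉τ ∘ proj₂ ∘ to (⟨rᵇs⟩∼⇔ b τ)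

  ⟨rᵇs⟩≁⟨rᵇs⟩ : ∀ b c → ¬ ⟨rᵇs⟩ b ∼ ⟨rᵇs⟩ c
  ⟨rᵇs⟩≁⟨rᵇs⟩ b c b∼c = let (b≢c , b∈c) = to (⟨rᵇs⟩∼⇔ b (⟨rᵇs⟩ c)) b∼c
                        in b≢c (cong ⟨rᵇs⟩ (toℕ%-injective b∈c))

  ⟨r⟩∼⟨rᵖ⟩ : ⟨r⟩ ∼ ⟨rᵖ⟩
  ⟨r⟩∼⟨rᵖ⟩ = ∼-via-rᵖ ⟨r⟩ ⟨rᵖ⟩ (λ ()) (1∣ _) (∣rᵖ ∣-refl)

  ⟨r⟩∼⟨rᵖ,rⁱs⟩ : ∀ i → ⟨r⟩ ∼ ⟨rᵖ,rⁱs⟩ i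
  ⟨r⟩∼⟨rᵖ,rⁱs⟩ i = ∼-via-rᵖ ⟨r⟩ (⟨rᵖ,rⁱs⟩ i) (λ ()) (1∣ _) (∣rᵖ ∣-refl)

  ⟨rᵖ⟩∼⟨rᵖ,rⁱs⟩ : ∀ i → ⟨rᵖ⟩ ∼ ⟨rᵖ,rⁱs⟩ i
  ⟨rᵖ⟩∼⟨rᵖ,rⁱs⟩ i = ∼-via-rᵖ ⟨rᵖ⟩ (⟨rᵖ,rⁱs⟩ i) (λ ()) (∣rᵖ ∣-refl) (∣rᵖ ∣-refl)

  -- enumerating b = p q + i through (q , i) makes the residue b mod p = i visible
  reflectionIndices : List (Fin n)
  reflectionIndices = cartesianProductWith combine (allFin P) (allFin P)

  combine-residue : ∀ (q i : Fin P) → toℕ (combine q i) % P ≡ toℕ i % P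
  combine-residue q i = begin
    toℕ (combine q i) % P   ≡⟨ cong (_% P) (toℕ-combine q i) ⟩
    (P * toℕ q + toℕ i) % P ≡⟨ %-remove-+ˡ (toℕ i) (m∣m*n (toℕ q)) ⟩
    toℕ i % P               ∎

  cyclics dihedrals reflections codes : List Code
  cyclics     = ⟨r⟩ ∷ ⟨rᵖ⟩ ∷ []
  dihedrals   = map ⟨rᵖ,rⁱs⟩ (allFin P)
  reflections = map ⟨rᵇs⟩ reflectionIndices
  codes       = cyclics ++ dihedrals ++ reflections

  codes-complete : ∀ σ → σ ∈ˡ codes
  codes-complete ⟨r⟩          = here refl
  codes-complete ⟨rᵖ⟩         = there (here refl)
  codes-complete (⟨rᵖ,rⁱs⟩ i) = there (there (∈-++⁺ˡ (∈-map⁺ ⟨rᵖ,rⁱs⟩ (∈-allFin i))))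
  codes-complete (⟨rᵇs⟩ b)    = there (there (∈-++⁺ʳ dihedrals (∈-map⁺ ⟨rᵇs⟩
    (let (q , i , q·i≡b) = combine-surjective {P} {P} b
     in subst (_∈ˡ reflectionIndices) q·i≡b (∈-cartesianProductWith⁺ combine (∈-allFin q) (∈-allFin i))))))

  codes-unique : Unique codes
  codes-unique = ((λ ()) ∷ ≢dihedrals++reflections (λ ()) (λ ())) ∷ ≢dihedrals++reflections (λ ()) (λ ())
               ∷ Unique.++⁺ (Unique.map⁺ (λ { refl → refl }) (Unique.allFin⁺ P))
                            (Unique.map⁺ (λ { refl → refl }) (Unique.cartesianProductWith⁺ combine
                              (λ {w} {x} {y} {z} → combine-injective w y x z) (Unique.allFin⁺ P) (Unique.allFin⁺ P)))
                            dihedral≢reflection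
    where
    ≢dihedrals++reflections : ∀ {σ} → (∀ {i} → σ ≢ ⟨rᵖ,rⁱs⟩ i) → (∀ {b} → σ ≢ ⟨rᵇs⟩ b) →
                              All (σ ≢_) (dihedrals ++ reflections)
    ≢dihedrals++reflections σ≢d σ≢r = All.++⁺ (All.map⁺ (All.universal (λ i → σ≢d {i}) (allFin P)))
                                              (All.map⁺ (All.universal (λ b → σ≢r {b}) reflectionIndices))
    dihedral≢reflection : ∀ {σ} → ¬ (σ ∈ˡ dihedrals × σ ∈ˡ reflections)
    dihedral≢reflection (σ∈ , σ∈′) with ∈-map⁻ ⟨rᵖ,rⁱs⟩ σ∈ | ∈-map⁻ ⟨rᵇs⟩ σ∈′
    ... | _ , _ , refl | _ , _ , ()

  vertices↭ : Prime P → vertices n ↭ map ⟦_⟧ codes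
  vertices↭ p-prime = unique∧set⇒↭
    (Unique.filter⁺ (isVertex? n) (allSubsets-unique (n + n)))
    (Unique.map⁺ ⟦⟧-injective codes-unique)
    (mk⇔ forward backward)
    where
    forward : ∀ {H} → H ∈ˡ vertices n → H ∈ˡ map ⟦_⟧ codes
    forward H∈ =
      let (σ , H≡⟦σ⟧) = vertex⇒≡⟦⟧ p-prime (proj₂ (∈-filter⁻ (isVertex? n) {xs = allSubsets (n + n)} H∈))
      in subst (_∈ˡ _) (sym H≡⟦σ⟧) (∈-map⁺ ⟦_⟧ (codes-complete σ))
    backward : ∀ {H} → H ∈ˡ map ⟦_⟧ codes → H ∈ˡ vertices n
    backward {H} H∈ =
      let (σ , _ , H≡⟦σ⟧) = ∈-map⁻ ⟦_⟧ {xs = codes} H∈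
      in ∈-filter⁺ (isVertex? n) (allSubsets-complete H) (subst (IsVertex n) (sym H≡⟦σ⟧) (⟦⟧-isVertex σ))

  neighbours-split : ∀ {ℓ} {Q : Pred Code ℓ} (Q? : Decidable Q) →
    length (filter Q? codes) ≡ length (filter Q? cyclics) +
      (length (filter (Q? ∘ ⟨rᵖ,rⁱs⟩) (allFin P)) + length (filter (Q? ∘ ⟨rᵇs⟩) reflectionIndices))
  neighbours-split Q? = begin
    length (filter Q? codes)
      ≡⟨ length-filter-++ Q? cyclics (dihedrals ++ reflections) ⟩
    length (filter Q? cyclics) + length (filter Q? (dihedrals ++ reflections))
      ≡⟨ cong (length (filter Q? cyclics) +_) (length-filter-++ Q? dihedrals reflections) ⟩
    length (filter Q? cyclics) + (length (filter Q? dihedrals) + length (filter Q? reflections))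
      ≡⟨ cong (λ t → length (filter Q? cyclics) + t)
              (cong₂ _+_ (length-filter-map Q? ⟨rᵖ,rⁱs⟩ (allFin P))
                         (length-filter-map Q? ⟨rᵇs⟩ reflectionIndices)) ⟩
    length (filter Q? cyclics) +
      (length (filter (Q? ∘ ⟨rᵖ,rⁱs⟩) (allFin P)) + length (filter (Q? ∘ ⟨rᵇs⟩) reflectionIndices)) ∎

  #cyclic #dihedral #reflection : Code → ℕ
  #cyclic ⟨r⟩          = 1
  #cyclic ⟨rᵖ⟩         = 1
  #cyclic (⟨rᵖ,rⁱs⟩ _) = 2
  #cyclic (⟨rᵇs⟩ _)    = 0
  #dihedral ⟨r⟩          = P
  #dihedral ⟨rᵖ⟩         = P
  #dihedral (⟨rᵖ,rⁱs⟩ _) = suc k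
  #dihedral (⟨rᵇs⟩ _)    = 1
  #reflection ⟨r⟩          = 0
  #reflection ⟨rᵖ⟩         = 0
  #reflection (⟨rᵖ,rⁱs⟩ _) = P
  #reflection (⟨rᵇs⟩ _)    = 0

  deg : Code → ℕ
  deg σ = #cyclic σ + (#dihedral σ + #reflection σ)

  cyclic-neighbours : ∀ σ → length (filter (σ ∼?_) cyclics) ≡ #cyclic σ
  cyclic-neighbours ⟨r⟩ =
    cong length (trans (filter-reject (⟨r⟩ ∼?_) {⟨r⟩} {⟨rᵖ⟩ ∷ []} (∼-irrefl ⟨r⟩))
                       (filter-accept (⟨r⟩ ∼?_) {⟨rᵖ⟩} {[]} ⟨r⟩∼⟨rᵖ⟩))
  cyclic-neighbours ⟨rᵖ⟩ =
    cong length (trans (filter-accept (⟨rᵖ⟩ ∼?_) {⟨r⟩} {⟨rᵖ⟩ ∷ []} (∼-sym ⟨r⟩ ⟨rᵖ⟩ ⟨r⟩∼⟨rᵖ⟩))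
                       (cong (⟨r⟩ ∷_) (filter-reject (⟨rᵖ⟩ ∼?_) {⟨rᵖ⟩} {[]} (∼-irrefl ⟨rᵖ⟩))))
  cyclic-neighbours (⟨rᵖ,rⁱs⟩ i) = length-filter-all (⟨rᵖ,rⁱs⟩ i ∼?_) {cyclics}
    (∼-sym ⟨r⟩ (⟨rᵖ,rⁱs⟩ i) (⟨r⟩∼⟨rᵖ,rⁱs⟩ i) ∷ ∼-sym ⟨rᵖ⟩ (⟨rᵖ,rⁱs⟩ i) (⟨rᵖ⟩∼⟨rᵖ,rⁱs⟩ i) ∷ [])
  cyclic-neighbours (⟨rᵇs⟩ b) = length-filter-none (⟨rᵇs⟩ b ∼?_) {cyclics}
    (⟨rᵇs⟩≁ b ⟨r⟩ (λ ()) ∷ ⟨rᵇs⟩≁ b ⟨rᵖ⟩ (λ ()) ∷ [])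

  dihedral-neighbours : ∀ σ → length (filter ((σ ∼?_) ∘ ⟨rᵖ,rⁱs⟩) (allFin P)) ≡ #dihedral σ
  dihedral-neighbours ⟨r⟩ = trans
    (length-filter-all ((⟨r⟩ ∼?_) ∘ ⟨rᵖ,rⁱs⟩) (All.universal ⟨r⟩∼⟨rᵖ,rⁱs⟩ (allFin P))) (length-allFin P)
  dihedral-neighbours ⟨rᵖ⟩ = trans
    (length-filter-all ((⟨rᵖ⟩ ∼?_) ∘ ⟨rᵖ,rⁱs⟩) (All.universal ⟨rᵖ⟩∼⟨rᵖ,rⁱs⟩ (allFin P))) (length-allFin P)
  dihedral-neighbours (⟨rᵖ,rⁱs⟩ i) = suc-injective (trans
    (length-filter-≢ ((⟨rᵖ,rⁱs⟩ i ∼?_) ∘ ⟨rᵖ,rⁱs⟩) (Unique.allFin⁺ P) (∈-allFin i) (mk⇔ forward backward))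
    (length-allFin P))
    where
    forward : ∀ {j} → ⟨rᵖ,rⁱs⟩ i ∼ ⟨rᵖ,rⁱs⟩ j → j ≢ i
    forward {j} i∼j j≡i = proj₁ (to (∼⇔≢×Share (⟨rᵖ,rⁱs⟩ i) (⟨rᵖ,rⁱs⟩ j)) i∼j) (cong ⟨rᵖ,rⁱs⟩ (sym j≡i))
    backward : ∀ {j} → j ≢ i → ⟨rᵖ,rⁱs⟩ i ∼ ⟨rᵖ,rⁱs⟩ j
    backward {j} j≢i = ∼-via-rᵖ (⟨rᵖ,rⁱs⟩ i) (⟨rᵖ,rⁱs⟩ j) (λ { refl → j≢i refl }) (∣rᵖ ∣-refl) (∣rᵖ ∣-refl)
  dihedral-neighbours (⟨rᵇs⟩ b) =
    length-filter-≡ ((⟨rᵇs⟩ b ∼?_) ∘ ⟨rᵖ,rⁱs⟩) (Unique.allFin⁺ P) (∈-allFin (toℕ b mod P)) λ {j} →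
      ⇔-trans (⟨rᵇs⟩∼⟨rᵖ,rⁱs⟩⇔ b j) (mk⇔
        (λ b≡j → toℕ%-injective (trans (sym b≡j) (sym (toℕ-mod-% (toℕ b) P))))
        (λ { refl → sym (toℕ-mod-% (toℕ b) P) }))

  reflection-neighbours : ∀ σ → length (filter ((σ ∼?_) ∘ ⟨rᵇs⟩) reflectionIndices) ≡ #reflection σ
  reflection-neighbours ⟨r⟩ = length-filter-none ((⟨r⟩ ∼?_) ∘ ⟨rᵇs⟩)
    (All.universal (λ b → ⟨rᵇs⟩≁ b ⟨r⟩ (λ ()) ∘ ∼-sym ⟨r⟩ (⟨rᵇs⟩ b)) reflectionIndices)
  reflection-neighbours ⟨rᵖ⟩ = length-filter-none ((⟨rᵖ⟩ ∼?_) ∘ ⟨rᵇs⟩)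
    (All.universal (λ b → ⟨rᵇs⟩≁ b ⟨rᵖ⟩ (λ ()) ∘ ∼-sym ⟨rᵖ⟩ (⟨rᵇs⟩ b)) reflectionIndices)
  reflection-neighbours (⟨rᵖ,rⁱs⟩ i) = begin
    length (filter ((⟨rᵖ,rⁱs⟩ i ∼?_) ∘ ⟨rᵇs⟩) reflectionIndices)
      ≡⟨ length-filter-cartesianProductWith ((⟨rᵖ,rⁱs⟩ i ∼?_) ∘ ⟨rᵇs⟩) combine (allFin P) (allFin P)
           (λ q → length-filter-≡ ((⟨rᵖ,rⁱs⟩ i ∼?_) ∘ ⟨rᵇs⟩ ∘ combine q) (Unique.allFin⁺ P) (∈-allFin i)
                    (λ {j} → ⇔-trans (∼-sym⇔ q j) (residue⇔ q j))) ⟩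
    length (allFin P) * 1 ≡⟨ *-identityʳ _ ⟩
    length (allFin P)     ≡⟨ length-allFin P ⟩
    P                     ∎
    where
    ∼-sym⇔ : ∀ q j → ⟨rᵖ,rⁱs⟩ i ∼ ⟨rᵇs⟩ (combine q j) ⇔ ⟨rᵇs⟩ (combine q j) ∼ ⟨rᵖ,rⁱs⟩ i
    ∼-sym⇔ q j = mk⇔ (∼-sym (⟨rᵖ,rⁱs⟩ i) (⟨rᵇs⟩ (combine q j))) (∼-sym (⟨rᵇs⟩ (combine q j)) (⟨rᵖ,rⁱs⟩ i))
    residue⇔ : ∀ q j → ⟨rᵇs⟩ (combine q j) ∼ ⟨rᵖ,rⁱs⟩ i ⇔ j ≡ i
    residue⇔ q j = ⇔-trans (⟨rᵇs⟩∼⟨rᵖ,rⁱs⟩⇔ (combine q j) i)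
      (mk⇔ (λ qj≡i → toℕ%-injective (trans (sym (combine-residue q j)) qj≡i))
           (λ { refl → combine-residue q j }))
  reflection-neighbours (⟨rᵇs⟩ c) = length-filter-none ((⟨rᵇs⟩ c ∼?_) ∘ ⟨rᵇs⟩)
    (All.universal (⟨rᵇs⟩≁⟨rᵇs⟩ c) reflectionIndices)

  degree-⟦⟧ : Prime P → ∀ σ → degree n ⟦ σ ⟧ ≡ deg σ
  degree-⟦⟧ p-prime σ = begin
    degree n ⟦ σ ⟧                                    ≡⟨ ↭-length (filter-↭ (adjacent? ⟦ σ ⟧) (vertices↭ p-prime)) ⟩
    length (filter (adjacent? ⟦ σ ⟧) (map ⟦_⟧ codes)) ≡⟨ length-filter-map (adjacent? ⟦ σ ⟧) ⟦_⟧ codes ⟩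
    length (filter (σ ∼?_) codes)                     ≡⟨ neighbours-split (σ ∼?_) ⟩
    _                                                 ≡⟨ cong₂ _+_ (cyclic-neighbours σ)
                                                           (cong₂ _+_ (dihedral-neighbours σ) (reflection-neighbours σ)) ⟩
    deg σ                                             ∎

  sum-over-codes : ∀ (g : Code → ℕ) {d r} → (∀ i → g (⟨rᵖ,rⁱs⟩ i) ≡ d) → (∀ b → g (⟨rᵇs⟩ b) ≡ r) →
                   sum (map g codes) ≡ sum (map g cyclics) + (P * d + P * P * r)
  sum-over-codes g {d} {r} g-dihedral g-reflection = begin
    sum (map g codes)
      ≡⟨ cong sum (map-++ g cyclics (dihedrals ++ reflections)) ⟩
    sum (map g cyclics ++ map g (dihedrals ++ reflections))
      ≡⟨ sum-++ (map g cyclics) (map g (dihedrals ++ reflections)) ⟩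
    sum (map g cyclics) + sum (map g (dihedrals ++ reflections))
      ≡⟨ cong (sum (map g cyclics) +_)
              (trans (cong sum (map-++ g dihedrals reflections)) (sum-++ (map g dihedrals) (map g reflections))) ⟩
    sum (map g cyclics) + (sum (map g dihedrals) + sum (map g reflections))
      ≡⟨ cong (λ t → sum (map g cyclics) + t) (cong₂ _+_ dihedral-sum reflection-sum) ⟩
    sum (map g cyclics) + (P * d + P * P * r) ∎
    where
    dihedral-sum : sum (map g dihedrals) ≡ P * d
    dihedral-sum = begin
      sum (map g (map ⟨rᵖ,rⁱs⟩ (allFin P))) ≡⟨ cong sum (map-∘ {g = g} {f = ⟨rᵖ,rⁱs⟩} (allFin P)) ⟨
      sum (map (g ∘ ⟨rᵖ,rⁱs⟩) (allFin P))   ≡⟨ sum-map-const (g ∘ ⟨rᵖ,rⁱs⟩) g-dihedral (allFin P) ⟩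
      length (allFin P) * d                 ≡⟨ cong (_* d) (length-allFin P) ⟩
      P * d                                 ∎
    reflection-sum : sum (map g reflections) ≡ P * P * r
    reflection-sum = begin
      sum (map g (map ⟨rᵇs⟩ reflectionIndices))
        ≡⟨ cong sum (map-∘ {g = g} {f = ⟨rᵇs⟩} reflectionIndices) ⟨
      sum (map (g ∘ ⟨rᵇs⟩) reflectionIndices)
        ≡⟨ sum-map-const (g ∘ ⟨rᵇs⟩) g-reflection reflectionIndices ⟩
      length reflectionIndices * r
        ≡⟨ cong (_* r) (length-cartesianProductWith combine (allFin P) (allFin P)) ⟩
      length (allFin P) * length (allFin P) * r
        ≡⟨ cong (λ t → t * t * r) (length-allFin P) ⟩
      P * P * r ∎

  M₁-formula : Prime P → M₁ n ≡ 2 * (1 + P) ^ 2 + P * (1 + 2 * P) ^ 2 + P * P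
  M₁-formula p-prime = begin
    M₁ n
      ≡⟨ sum-↭ (↭-map⁺ (λ H → degree n H ^ 2) (vertices↭ p-prime)) ⟩
    sum (map (λ H → degree n H ^ 2) (map ⟦_⟧ codes))
      ≡⟨ cong sum (map-∘ {g = λ H → degree n H ^ 2} {f = ⟦_⟧} codes) ⟨
    sum (map (λ σ → degree n ⟦ σ ⟧ ^ 2) codes)
      ≡⟨ cong sum (map-cong (λ σ → cong (_^ 2) (degree-⟦⟧ p-prime σ)) codes) ⟩
    sum (map (λ σ → deg σ ^ 2) codes)
      ≡⟨ sum-over-codes (λ σ → deg σ ^ 2) (λ _ → refl) (λ _ → refl) ⟩
    (1 + (P + 0)) ^ 2 + ((1 + (P + 0)) ^ 2 + 0) + (P * (2 + (suc k + P)) ^ 2 + P * P * 1)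
      ≡⟨ expand k ⟩
    2 * (1 + P) ^ 2 + P * (1 + 2 * P) ^ 2 + P * P ∎
    where
    expand : ∀ k → let P = suc (suc k) in
      (1 + (P + 0)) * ((1 + (P + 0)) * 1) + ((1 + (P + 0)) * ((1 + (P + 0)) * 1) + 0) +
        (P * ((2 + (suc k + P)) * ((2 + (suc k + P)) * 1)) + P * P * 1)
      ≡ 2 * ((1 + P) * ((1 + P) * 1)) + P * ((1 + 2 * P) * ((1 + 2 * P) * 1)) + P * P
    expand = solve-∀

zagreb-polynomial : ∀ p → 2 * (1 + p) ^ 2 + p * (1 + 2 * p) ^ 2 + p * p ≡ 4 * p ^ 3 + 7 * p ^ 2 + 5 * p + 2
zagreb-polynomial = expanded
  where
  expanded : ∀ p → 2 * ((1 + p) * ((1 + p) * 1)) + p * ((1 + 2 * p) * ((1 + 2 * p) * 1)) + p * p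
                 ≡ 4 * (p * (p * (p * 1))) + 7 * (p * (p * 1)) + 5 * p + 2
  expanded = solve-∀

theorem3p3 : (p : ℕ) → Prime p →
    M₁ (p ^ 2) ≡ 4 * p ^ 3 + 7 * p ^ 2 + 5 * p + 2
theorem3p3 0 p-prime = ⊥-elim (NonTrivial.nonTrivial (prime⇒nonTrivial p-prime))
theorem3p3 1 p-prime = ⊥-elim (NonTrivial.nonTrivial (prime⇒nonTrivial p-prime))
theorem3p3 p@(suc (suc k)) p-prime = begin
  M₁ (p ^ 2)                                    ≡⟨ cong (M₁ ∘ (p *_)) (*-identityʳ p) ⟩
  M₁ (p * p)                                    ≡⟨ M₁-formula p-prime ⟩
  2 * (1 + p) ^ 2 + p * (1 + 2 * p) ^ 2 + p * p ≡⟨ zagreb-polynomial p ⟩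
  4 * p ^ 3 + 7 * p ^ 2 + 5 * p + 2             ∎
  where open DihedralOfOrder2p² k
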